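{- Let $T$ be a tree with $\operatorname{diam}(T)=5$ whose center is the edge $e_1e_2$ (with vertices $e_1,e_2$). Let $S$ be the set of support vertices of $T$ and $s=|S|$. Then \[ \chi_d^t(T)=\begin{cases} s+1 & \text{if } e_1,e_2\in S,\\ s+2 & \text{if } |S|=2, \text{ or } |S\cap\{e_1,e_2\}|=1,\\ s+3 & \text{if } S\cap\{e_1,e_2\}=\emptyset \text{ and } |S|\geq 3.\end{cases} \]
   Context: $\operatorname{diam}(T)$ is the maximum distance between two vertices. The eccentricity of a vertex $u$ is $\max_{v}d(u,v)$; the center of a graph is the subgraph induced by the vertices of minimum eccentricity (for a tree it is a single vertex or an edge). In a tree, a leaf is a vertex of degree one, and a support vertex is a neighbor of a leaf that has degree more than one. A total dominator coloring of a graph $G$ is a proper vertex coloring of $G$ in which each vertex of $G$ is adjacent to every vertex of some color class; $\chi_d^t(G)$ is the minimum number of color classes in a total dominator coloring of $G$. -}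

module Defs where

open import Data.Nat using (ℕ; zero; suc; _+_; _≤_; _<_; _≥_)
open import Data.Bool using (Bool; T)
open import Data.Fin using (Fin)
open import Data.Fin.Subset using (Subset; _∈_; _∉_; ∣_∣)
open import Data.List using (List; []; _∷_; _++_; length; filterᵇ; allFin)
open import Data.List.Relation.Unary.Linked using (Linked)
open import Data.List.Relation.Unary.Unique.Propositional using (Unique)
open import Data.Product using (Σ; ∃; ∃-syntax; _×_; _,_)
open import Data.Sum using (_⊎_)
open import Data.Empty using (⊥)
open import Relation.Nullary using (¬_)
open import Relation.Binary.PropositionalEquality using (_≡_; _≢_)
open import Function.Base using (_∘_)

record Graph (n : ℕ) : Set where
  field
    adj   : Fin n → Fin n → Bool
    sym   : ∀ u v → T (adj u v) → T (adj v u)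
    irrefl : ∀ u → ¬ T (adj u u)

module _ {n : ℕ} (G : Graph n) where
  open Graph G

  Adj : Fin n → Fin n → Set
  Adj u v = T (adj u v)

  data Walk : Fin n → Fin n → ℕ → Set where
    here : ∀ {u} → Walk u u 0
    step : ∀ {u w v k} → Adj u w → Walk w v k → Walk u v (suc k)

  Connected : Set
  Connected = ∀ u v → ∃[ k ] Walk u v k

  -- a cycle: distinct vertices x, m₁, …, mⱼ, y (j ≥ 1), consecutive ones
  -- adjacent, and y adjacent to x
  HasCycle : Set
  HasCycle = ∃[ x ] ∃[ y ] ∃[ ms ]
    (1 ≤ length ms × Linked Adj (x ∷ ms ++ y ∷ []) ×
     Unique (x ∷ ms ++ y ∷ []) × Adj y x)

  IsTree : Set
  IsTree = Connected × ¬ HasCycle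

  IsDist : Fin n → Fin n → ℕ → Set
  IsDist u v k = Walk u v k × (∀ m → Walk u v m → k ≤ m)

  Diam : ℕ → Set
  Diam D = (∃[ u ] ∃[ v ] IsDist u v D) × (∀ u v k → IsDist u v k → k ≤ D)

  Ecc : Fin n → ℕ → Set
  Ecc u e = (∃[ v ] IsDist u v e) × (∀ v k → IsDist u v k → k ≤ e)

  InCenter : Fin n → Set
  InCenter u = ∃[ e ] (Ecc u e × (∀ w e′ → Ecc w e′ → e ≤ e′))

  CenterIsEdge : Fin n → Fin n → Set
  CenterIsEdge e₁ e₂ = e₁ ≢ e₂ × Adj e₁ e₂ × InCenter e₁ × InCenter e₂ ×
    (∀ w → InCenter w → w ≡ e₁ ⊎ w ≡ e₂)

  degree : Fin n → ℕ
  degree u = length (filterᵇ (adj u) (allFin n))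

  IsLeaf : Fin n → Set
  IsLeaf u = degree u ≡ 1

  IsSupport : Fin n → Set
  IsSupport u = (∃[ v ] (Adj u v × IsLeaf v)) × 1 < degree u

  IsTDC : (k : ℕ) → (Fin n → Fin k) → Set
  IsTDC k c =
    (∀ u v → Adj u v → c u ≢ c v) ×
    (∀ i → ∃[ u ] c u ≡ i) ×
    (∀ u → ∃[ i ] (∀ v → c v ≡ i → Adj u v))

  HasTDC : ℕ → Set
  HasTDC k = Σ (Fin n → Fin k) (IsTDC k)

  χdt≡ : ℕ → Set
  χdt≡ k = HasTDC k × (∀ k′ → HasTDC k′ → k ≤ k′)

module Submission where

-- Idea.  A longest path x₀ x₁ c₁ c₂ y₁ y₀, with every vertex within distance 3 of
-- both c₁ and c₂ (a "frame"), pins down the shape of T: every vertex is a leaf, a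
-- support vertex, c₁ or c₂; a support vertex other than c₁, c₂ is adjacent to one
-- of them; and c₁c₂ is the only edge between non-support vertices.  In every total
-- dominator colouring each support vertex forms a class of its own (the class its
-- leaf dominates), so χ_d^t(T) = ∣ S ∣ + m, where m counts the colours needed on
-- the non-support vertices.  In each case a colouring with m = 1, 2 or 3 is built,
-- and fewer are excluded using the classes dominated by x₁, y₁ and, when
-- ∣ S ∣ ≥ 3, by a third support vertex.

open import Defs
open import Data.Nat using (ℕ; zero; suc; _+_; _≤_; _<_; _≥_; z≤n; s≤s; s≤s⁻¹; _≤?_)
open import Data.Nat.Properties using (≤-refl; ≤-trans; ≤-antisym; m≤n⇒m≤1+n; ≤∧≢⇒<; +-mono-≤; ≰⇒>)
  renaming (_≟_ to _≟ℕ_)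
open import Data.Bool using (true; false)
open import Data.Bool.Properties using (T?)
open import Data.Fin using (Fin; zero; suc; splitAt; _↑ˡ_; _↑ʳ_)
open import Data.Fin.Properties
  using (_≟_; any?; injective⇒≤; suc-injective; ↑ˡ-injective; ↑ʳ-injective;
         splitAt-↑ˡ; splitAt-↑ʳ; splitAt⁻¹-↑ˡ; splitAt⁻¹-↑ʳ)
open import Data.Fin.Subset using (Subset; _∈_; _∉_; ∣_∣)
open import Data.Fin.Subset.Properties using (_∈?_)
open import Data.Vec using ([]; _∷_; lookup; here; there)
open import Data.List using (List; []; _∷_; _++_; length; filterᵇ; allFin)
open import Data.List.Properties using (++-assoc)
open import Data.List.Relation.Unary.Linked using (Linked; []; [-]; _∷_)
open import Data.List.Relation.Unary.All as All using (All; []; _∷_)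
import Data.List.Relation.Unary.All.Properties as AllP
open import Data.List.Relation.Unary.Any using (here; there)
open import Data.List.Relation.Unary.AllPairs using ([]; _∷_)
open import Data.List.Relation.Unary.Unique.Propositional using (Unique)
open import Data.List.Relation.Unary.Unique.Propositional.Properties using (allFin⁺; filter⁺)
open import Data.List.Membership.Propositional using () renaming (_∈_ to _∈ₗ_)
open import Data.List.Membership.Propositional.Properties using (∈-allFin; ∈-filter⁺; ∈-filter⁻)
open import Data.Product using (Σ; ∃; ∃₂; _×_; _,_; proj₁; proj₂)
open import Data.Sum using (_⊎_; inj₁; inj₂)
open import Data.Unit using (⊤; tt)
open import Data.Empty using (⊥; ⊥-elim)
open import Function.Base using (_∘_)
open import Function.Bundles using (_⇔_; Equivalence)
open import Relation.Nullary using (¬_; Dec; yes; no)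
open import Relation.Nullary.Decidable using (_×-dec_; ¬?)
open import Relation.Binary.PropositionalEquality
  using (_≡_; _≢_; refl; sym; trans; cong; subst; subst₂; ≢-sym)

-- Enumerating a subset p of Fin n: `enum p` lists its elements in increasing
-- order and `rank p` is the inverse, numbering each member of p.  Together they
-- identify p with Fin ∣ p ∣, which is how cardinalities of subsets are compared.
module Enumeration where

  enum : ∀ {n} (p : Subset n) → Fin ∣ p ∣ → Fin n
  enum (true ∷ p) zero = zero
  enum (true ∷ p) (suc i) = suc (enum p i)
  enum (false ∷ p) i = suc (enum p i)

  enum∈ : ∀ {n} (p : Subset n) (i : Fin ∣ p ∣) → enum p i ∈ p
  enum∈ (true ∷ p) zero = here
  enum∈ (true ∷ p) (suc i) = there (enum∈ p i)
  enum∈ (false ∷ p) i = there (enum∈ p i)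

  enum-injective : ∀ {n} (p : Subset n) i j → enum p i ≡ enum p j → i ≡ j
  enum-injective (true ∷ p) zero zero e = refl
  enum-injective (true ∷ p) (suc i) (suc j) e = cong suc (enum-injective p i j (suc-injective e))
  enum-injective (false ∷ p) i j e = enum-injective p i j (suc-injective e)

  rank : ∀ {n} (p : Subset n) (x : Fin n) → x ∈ p → Fin ∣ p ∣
  rank (true ∷ p) zero here = zero
  rank (true ∷ p) (suc x) (there m) = suc (rank p x m)
  rank (false ∷ p) (suc x) (there m) = rank p x m

  enum-rank : ∀ {n} (p : Subset n) x (m : x ∈ p) → enum p (rank p x m) ≡ x
  enum-rank (true ∷ p) zero here = refl
  enum-rank (true ∷ p) (suc x) (there m) = cong suc (enum-rank p x m)
  enum-rank (false ∷ p) (suc x) (there m) = cong suc (enum-rank p x m)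

  rank-enum : ∀ {n} (p : Subset n) i (m : enum p i ∈ p) → rank p (enum p i) m ≡ i
  rank-enum (true ∷ p) zero here = refl
  rank-enum (true ∷ p) (suc i) (there m) = cong suc (rank-enum p i m)
  rank-enum (false ∷ p) i (there m) = rank-enum p i m

  rank-injective : ∀ {n} (p : Subset n) x y (mx : x ∈ p) (my : y ∈ p) →
                   rank p x mx ≡ rank p y my → x ≡ y
  rank-injective p x y mx my e =
    trans (sym (enum-rank p x mx)) (trans (cong (enum p) e) (enum-rank p y my))

  -- Membership proofs in a subset are unique, so `rank` does not depend on them.
  ∈-irrelevant : ∀ {n} (p : Subset n) x (a b : x ∈ p) → a ≡ b
  ∈-irrelevant (true ∷ p) zero here here = refl
  ∈-irrelevant (_ ∷ p) (suc x) (there a) (there b) = cong there (∈-irrelevant p x a b)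

module Counting where
  open Enumeration

  injective-on-plus : ∀ {n k} (S : Subset n) (c : Fin n → Fin k) →
    (∀ w w′ → w ∈ S → w′ ∈ S → c w ≡ c w′ → w ≡ w′) →
    ∀ m (xs : Fin m → Fin n) → (∀ j w → w ∈ S → c (xs j) ≢ c w) →
    (∀ j j′ → c (xs j) ≡ c (xs j′) → j ≡ j′) → ∣ S ∣ + m ≤ k
  injective-on-plus S c injS m xs apart inj = injective⇒≤ {f = g} g-injective
    where
    g′ : Fin ∣ S ∣ ⊎ Fin m → Fin _
    g′ (inj₁ i) = c (enum S i)
    g′ (inj₂ j) = c (xs j)
    g : Fin (∣ S ∣ + m) → Fin _
    g i = g′ (splitAt ∣ S ∣ i)
    g′-injective : ∀ a b → g′ a ≡ g′ b → a ≡ b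
    g′-injective (inj₁ i) (inj₁ i′) e =
      cong inj₁ (enum-injective S i i′ (injS _ _ (enum∈ S i) (enum∈ S i′) e))
    g′-injective (inj₁ i) (inj₂ j) e = ⊥-elim (apart j _ (enum∈ S i) (sym e))
    g′-injective (inj₂ j) (inj₁ i) e = ⊥-elim (apart j _ (enum∈ S i) e)
    g′-injective (inj₂ j) (inj₂ j′) e = cong inj₂ (inj j j′ e)
    g-injective : ∀ {a b} → g a ≡ g b → a ≡ b
    g-injective {a} {b} e with splitAt ∣ S ∣ {m} a in ea | splitAt ∣ S ∣ {m} b in eb
    ... | x | y with g′-injective x y e
    ... | refl with x
    ... | inj₁ _ = trans (sym (splitAt⁻¹-↑ˡ ea)) (splitAt⁻¹-↑ˡ eb)
    ... | inj₂ _ = trans (sym (splitAt⁻¹-↑ʳ ea)) (splitAt⁻¹-↑ʳ eb)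

  three-members : ∀ {n} (S : Subset n) x y z → x ∈ S → y ∈ S → z ∈ S →
                  x ≢ y → x ≢ z → y ≢ z → 3 ≤ ∣ S ∣
  three-members S x y z mx my mz xy xz yz = injective⇒≤ {f = f} f-injective
    where
    f : Fin 3 → Fin ∣ S ∣
    f zero = rank S x mx
    f (suc zero) = rank S y my
    f (suc (suc zero)) = rank S z mz
    distinct : ∀ {a b} → a ≢ b → ∀ ma mb → rank S a ma ≢ rank S b mb
    distinct ne ma mb e = ne (rank-injective S _ _ ma mb e)
    f-injective : ∀ {a b} → f a ≡ f b → a ≡ b
    f-injective {zero} {zero} e = refl
    f-injective {zero} {suc zero} e = ⊥-elim (distinct xy _ _ e)
    f-injective {zero} {suc (suc zero)} e = ⊥-elim (distinct xz _ _ e)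
    f-injective {suc zero} {zero} e = ⊥-elim (distinct xy _ _ (sym e))
    f-injective {suc zero} {suc zero} e = refl
    f-injective {suc zero} {suc (suc zero)} e = ⊥-elim (distinct yz _ _ e)
    f-injective {suc (suc zero)} {zero} e = ⊥-elim (distinct xz _ _ (sym e))
    f-injective {suc (suc zero)} {suc zero} e = ⊥-elim (distinct yz _ _ (sym e))
    f-injective {suc (suc zero)} {suc (suc zero)} e = refl

  two-members-exhaust : ∀ {n} (S : Subset n) x y → ∣ S ∣ ≤ 2 → x ∈ S → y ∈ S → x ≢ y →
                        ∀ z → z ∈ S → z ≡ x ⊎ z ≡ y
  two-members-exhaust S x y small mx my xy z mz with z ≟ x | z ≟ y
  ... | yes e | _ = inj₁ e
  ... | no _ | yes e = inj₂ e
  ... | no zx | no zy with ≤-trans (three-members S x y z mx my mz xy (≢-sym zx) (≢-sym zy)) small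
  ... | s≤s (s≤s ())

  covered-by-two : ∀ {n} (S : Subset n) x y → (∀ z → z ∈ S → z ≡ x ⊎ z ≡ y) → ∣ S ∣ ≤ 2
  covered-by-two S x y h = injective⇒≤ {f = f} f-injective
    where
    f : Fin ∣ S ∣ → Fin 2
    f i with enum S i ≟ x
    ... | yes _ = zero
    ... | no _ = suc zero
    f-injective : ∀ {i j} → f i ≡ f j → i ≡ j
    f-injective {i} {j} e with enum S i ≟ x | enum S j ≟ x
    ... | yes p | yes q = enum-injective S i j (trans p (sym q))
    ... | no p | no q with h _ (enum∈ S i) | h _ (enum∈ S j)
    ... | inj₁ p′ | _ = ⊥-elim (p p′)
    ... | inj₂ _ | inj₁ q′ = ⊥-elim (q q′)
    ... | inj₂ p′ | inj₂ q′ = enum-injective S i j (trans p′ (sym q′))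

module ListFacts {A : Set} where

  member⇒nonempty : ∀ {x : A} {xs} → x ∈ₗ xs → 1 ≤ length xs
  member⇒nonempty {xs = _ ∷ _} _ = s≤s z≤n

  nonempty⇒member : ∀ (xs : List A) → 1 ≤ length xs → ∃ λ x → x ∈ₗ xs
  nonempty⇒member (x ∷ _) _ = x , here refl

  short⇒members-equal : ∀ {xs} {x y : A} → length xs ≤ 1 → x ∈ₗ xs → y ∈ₗ xs → x ≡ y
  short⇒members-equal {_ ∷ []} _ (here refl) (here refl) = refl
  short⇒members-equal {_ ∷ _ ∷ _} (s≤s ()) _ _

  unique-constant⇒short : ∀ {xs} (v : A) → Unique xs → (∀ {w} → w ∈ₗ xs → w ≡ v) → length xs ≤ 1
  unique-constant⇒short {[]} v _ _ = z≤n
  unique-constant⇒short {_ ∷ []} v _ _ = s≤s z≤n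
  unique-constant⇒short {_ ∷ _ ∷ _} v ((x≢y ∷ _) ∷ _) h =
    ⊥-elim (x≢y (trans (h (here refl)) (sym (h (there (here refl))))))

  split : ∀ {x : A} {xs} → x ∈ₗ xs → ∃₂ λ pre post → xs ≡ pre ++ x ∷ post
  split {xs = y ∷ ys} (here refl) = [] , ys , refl
  split {xs = y ∷ ys} (there m) with split m
  ... | pre , post , refl = y ∷ pre , post , refl

  init-last : (a : A) (as : List A) → ∃₂ λ ms y → a ∷ as ≡ ms ++ y ∷ []
  init-last a [] = [] , a , refl
  init-last a (b ∷ bs) with init-last b bs
  ... | ms , y , e = a ∷ ms , y , cong (a ∷_) e

  unique-prefix : ∀ (xs ys : List A) → Unique (xs ++ ys) → Unique xs
  unique-prefix [] ys u = []
  unique-prefix (x ∷ xs) ys (a ∷ u) = AllP.++⁻ˡ xs a ∷ unique-prefix xs ys u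

  unique-middle : ∀ (xs : List A) y ys → Unique (xs ++ y ∷ ys) → All (y ≢_) xs
  unique-middle [] y ys u = []
  unique-middle (x ∷ xs) y ys (a ∷ u) = y≢x ∷ unique-middle xs y ys u
    where
    y∈ : ∀ zs → y ∈ₗ zs ++ y ∷ ys
    y∈ [] = here refl
    y∈ (z ∷ zs) = there (y∈ zs)
    y≢x : y ≢ x
    y≢x refl = All.lookup a (y∈ xs) refl

  module _ {R : A → A → Set} where
    linked-prefix : ∀ (xs ys : List A) → Linked R (xs ++ ys) → Linked R xs
    linked-prefix [] ys l = []
    linked-prefix (x ∷ []) ys l = [-]
    linked-prefix (x ∷ y ∷ xs) ys (r ∷ l) = r ∷ linked-prefix (y ∷ xs) ys l

    linked-junction : ∀ (ms : List A) y z zs → Linked R (ms ++ y ∷ z ∷ zs) → R y z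
    linked-junction [] y z zs (r ∷ l) = r
    linked-junction (m ∷ []) y z zs (r ∷ l) = linked-junction [] y z zs l
    linked-junction (m ∷ m′ ∷ ms) y z zs (r ∷ l) = linked-junction (m′ ∷ ms) y z zs l

module Degrees {n : ℕ} (G : Graph n) where
  open Graph G using (adj)
  open ListFacts

  nbrs : Fin n → List (Fin n)
  nbrs u = filterᵇ (adj u) (allFin n)

  nbrs-unique : ∀ u → Unique (nbrs u)
  nbrs-unique u = filter⁺ (T? ∘ adj u) (allFin⁺ n)

  adj⇒nbr : ∀ {u v} → Adj G u v → v ∈ₗ nbrs u
  adj⇒nbr {u} {v} a = ∈-filter⁺ (T? ∘ adj u) (∈-allFin v) a

  nbr⇒adj : ∀ {u v} → v ∈ₗ nbrs u → Adj G u v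
  nbr⇒adj {u} m = proj₂ (∈-filter⁻ (T? ∘ adj u) {xs = allFin n} m)

  adj⇒deg≥1 : ∀ {u v} → Adj G u v → 1 ≤ degree G u
  adj⇒deg≥1 a = member⇒nonempty (adj⇒nbr a)

  deg≤1⇒nbr-unique : ∀ {u v w} → degree G u ≤ 1 → Adj G u v → Adj G u w → v ≡ w
  deg≤1⇒nbr-unique d a b = short⇒members-equal d (adj⇒nbr a) (adj⇒nbr b)

  nbr-unique⇒deg≤1 : ∀ {u} v → (∀ w → Adj G u w → w ≡ v) → degree G u ≤ 1
  nbr-unique⇒deg≤1 {u} v h = unique-constant⇒short v (nbrs-unique u) (λ m → h _ (nbr⇒adj m))

  two-nbrs⇒deg≥2 : ∀ {u v w} → Adj G u v → Adj G u w → v ≢ w → 1 < degree G u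
  two-nbrs⇒deg≥2 {u} a b v≢w with degree G u ≤? 1
  ... | yes d = ⊥-elim (v≢w (deg≤1⇒nbr-unique d a b))
  ... | no d = ≰⇒> d

  leaf-nbr : ∀ {l} → IsLeaf G l → ∃ λ v → Adj G l v
  leaf-nbr {l} lf with nonempty⇒member (nbrs l) (subst (1 ≤_) (sym lf) ≤-refl)
  ... | v , m = v , nbr⇒adj m

  leaf-nbr-unique : ∀ {l v w} → IsLeaf G l → Adj G l v → Adj G l w → v ≡ w
  leaf-nbr-unique lf = deg≤1⇒nbr-unique (subst (_≤ 1) (sym lf) ≤-refl)

-- Walks in an acyclic graph.  A walk is non-backtracking (NB) if it never
-- returns to the vertex it has just left.  The central fact is that all NB walks
-- between two vertices have the same length (`nb-length-unique`); since every
-- walk can be shortened to an NB walk, an NB walk realises the distance.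
module AcyclicWalks {n : ℕ} (G : Graph n) (acyclic : ¬ HasCycle G) where
  open Graph G using (irrefl) renaming (sym to adj-sym)
  open ListFacts

  V : Set
  V = Fin n

  closing-chord : ∀ {u w x} pre post → Adj G u w → Unique (w ∷ x ∷ pre ++ u ∷ post) →
                  Linked (Adj G) (w ∷ x ∷ pre ++ u ∷ post) → ⊥
  closing-chord {u} {w} {x} pre post u~w uniq linked with init-last w (x ∷ pre)
  ... | ms , y , e = acyclic (u , y , ms , long , cycle-linked , cycle-unique , y~u)
    where
    e′ : w ∷ x ∷ pre ++ u ∷ post ≡ ms ++ y ∷ u ∷ post
    e′ = trans (cong (_++ u ∷ post) e) (++-assoc ms (y ∷ []) (u ∷ post))
    long : 1 ≤ length ms
    long = at-least-one ms e
      where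
      at-least-one : ∀ ms′ → w ∷ x ∷ pre ≡ ms′ ++ y ∷ [] → 1 ≤ length ms′
      at-least-one (_ ∷ _) _ = s≤s z≤n
    y~u : Adj G y u
    y~u = linked-junction ms y u post (subst (Linked (Adj G)) e′ linked)
    cycle-linked : Linked (Adj G) (u ∷ ms ++ y ∷ [])
    cycle-linked = subst (λ L → Linked (Adj G) (u ∷ L)) e
                     (u~w ∷ linked-prefix (w ∷ x ∷ pre) (u ∷ post) linked)
    cycle-unique : Unique (u ∷ ms ++ y ∷ [])
    cycle-unique = subst (λ L → Unique (u ∷ L)) e
      (unique-middle (w ∷ x ∷ pre) u post uniq ∷ unique-prefix (w ∷ x ∷ pre) (u ∷ post) uniq)

  NoBacktrack : List V → Set
  NoBacktrack (a ∷ b ∷ c ∷ r) = a ≢ c × NoBacktrack (b ∷ c ∷ r)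
  NoBacktrack _ = ⊤

  adj⇒≢ : ∀ {u v} → Adj G u v → u ≢ v
  adj⇒≢ {u} a refl = irrefl u a

  nb-list-unique : ∀ L → Linked (Adj G) L → NoBacktrack L → Unique L
  nb-list-unique [] _ _ = []
  nb-list-unique (u ∷ []) _ _ = [] ∷ []
  nb-list-unique (u ∷ w ∷ []) (a ∷ _) _ = (adj⇒≢ a ∷ []) ∷ [] ∷ []
  nb-list-unique (u ∷ w ∷ x ∷ r) (a ∷ l) (u≢x , nb) = (adj⇒≢ a ∷ u≢x ∷ All.tabulate far) ∷ rest
    where
    rest = nb-list-unique (w ∷ x ∷ r) l nb
    far : ∀ {z} → z ∈ₗ r → u ≢ z
    far m refl with split m
    ... | pre , post , refl = closing-chord pre post a rest l

  -- The vertex list of a walk (its head is visible even for an unknown walk).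
  verts : ∀ {u v k} → Walk G u v k → List V
  verts-after-start : ∀ {u v k} → Walk G u v k → List V
  verts {u} W = u ∷ verts-after-start W
  verts-after-start here = []
  verts-after-start (step _ W) = verts W

  verts-linked : ∀ {u v k} (W : Walk G u v k) → Linked (Adj G) (verts W)
  verts-linked here = [-]
  verts-linked (step a here) = a ∷ [-]
  verts-linked (step a (step b W)) = a ∷ verts-linked (step b W)

  end∈verts : ∀ {u v k} (W : Walk G u v k) → v ∈ₗ verts W
  end∈verts here = here refl
  end∈verts (step _ W) = there (end∈verts W)

  data NB : ∀ {u v k} → Walk G u v k → Set where
    nb-here : ∀ {u} → NB (here {u = u})
    nb-edge : ∀ {u v} (a : Adj G u v) → NB (step a here)
    nb-step : ∀ {u w x v k} (a : Adj G u w) (b : Adj G w x) (W : Walk G x v k) →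
              u ≢ x → NB (step b W) → NB (step a (step b W))

  nb-tail : ∀ {u w v k} {a : Adj G u w} {W : Walk G w v k} → NB (step a W) → NB W
  nb-tail (nb-edge a) = nb-here
  nb-tail (nb-step a b W x p) = p

  nb-verts : ∀ {u v k} {W : Walk G u v k} → NB W → NoBacktrack (verts W)
  nb-verts nb-here = tt
  nb-verts (nb-edge a) = tt
  nb-verts (nb-step a b W ne p) = ne , nb-verts p

  nb-not-closed : ∀ {x k} (W : Walk G x x (suc k)) → NB W → ⊥
  nb-not-closed (step a W) p
    with nb-list-unique (verts (step a W)) (verts-linked (step a W)) (nb-verts p)
  ... | x∉ ∷ _ = All.lookup x∉ (end∈verts W) refl

  revOnto : ∀ {s t k} → Walk G s t k → List V → List V
  revOnto {s} here acc = s ∷ acc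
  revOnto {s} (step a W) acc = revOnto W (s ∷ acc)

  Continues : ∀ {s t k} → Walk G s t k → List V → Set
  Continues (step {w = s₁} a W) (a₁ ∷ _) = s₁ ≢ a₁
  Continues _ _ = ⊤

  continues-tail : ∀ {s s₁ t k acc} {a : Adj G s s₁} (W : Walk G s₁ t k) →
                   NB (step a W) → Continues W (s ∷ acc)
  continues-tail here _ = tt
  continues-tail (step _ _) (nb-step _ _ _ ne _) = ne ∘ sym

  revOnto-nb : ∀ {s t k} (W : Walk G s t k) → NB W → ∀ acc →
               Linked (Adj G) (s ∷ acc) → NoBacktrack (s ∷ acc) → Continues W acc →
               Linked (Adj G) (revOnto W acc) × NoBacktrack (revOnto W acc)
  revOnto-nb here _ acc l nb c = l , nb
  revOnto-nb {s} (step {w = s₁} a W) p acc l nb c =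
    revOnto-nb W (nb-tail p) (s ∷ acc) (adj-sym _ _ a ∷ l) (extend acc c nb) (continues-tail W p)
    where
    extend : ∀ acc → Continues (step a W) acc → NoBacktrack (s ∷ acc) → NoBacktrack (s₁ ∷ s ∷ acc)
    extend [] _ _ = tt
    extend (_ ∷ _) c nb = c , nb

  revOnto-head : ∀ {s t k} (W : Walk G s t k) acc →
                 ∃ λ r → revOnto W acc ≡ t ∷ r × (∀ {z} → z ∈ₗ acc → z ∈ₗ r)
  revOnto-head here acc = acc , refl , λ m → m
  revOnto-head {s} (step a W) acc with revOnto-head W (s ∷ acc)
  ... | r , e , f = r , e , λ m → f (there m)

  -- If their first
  -- steps differ, P reversed followed by Q is a non-backtracking list starting
  -- and ending at y, contradicting that such lists are duplicate-free.
  nb-length-unique : ∀ {x y m m′} (P : Walk G x y m) (Q : Walk G x y m′) → NB P → NB Q → m ≡ m′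
  nb-length-unique here here _ _ = refl
  nb-length-unique here (step b Q) _ q = ⊥-elim (nb-not-closed (step b Q) q)
  nb-length-unique (step a P) here p _ = ⊥-elim (nb-not-closed (step a P) p)
  nb-length-unique (step {w = p₁} a P′) (step {w = q₁} b Q′) p q with p₁ ≟ q₁
  ... | yes refl = cong suc (nb-length-unique P′ Q′ (nb-tail p) (nb-tail q))
  ... | no p₁≢q₁ = ⊥-elim (y-repeated (revOnto-nb P′ (nb-tail p) Qs
                             (adj-sym _ _ a ∷ verts-linked (step b Q′)) (p₁≢q₁ , nb-verts q)
                             (continues-tail P′ p)))
    where
    Qs = verts (step b Q′)
    y-repeated : Linked (Adj G) (revOnto P′ Qs) × NoBacktrack (revOnto P′ Qs) → ⊥
    y-repeated (linked , nb) with revOnto-head P′ Qs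
    ... | r , e , Qs⊆r with subst Unique e (nb-list-unique _ linked nb)
    ... | y∉r ∷ _ = All.lookup y∉r (Qs⊆r (end∈verts (step b Q′))) refl

  shorten : ∀ {u v k} (W : Walk G u v k) → ∃ λ k′ → k′ ≤ k × Σ (Walk G u v k′) NB
  shorten here = 0 , z≤n , here , nb-here
  shorten (step {u} a W) with shorten W
  ... | .0 , le , here , _ = 1 , s≤s z≤n , step a here , nb-edge a
  ... | .(suc _) , le , step {w = x} b W″ , nbW with u ≟ x
  ...   | yes refl = _ , m≤n⇒m≤1+n (≤-trans (m≤n⇒m≤1+n ≤-refl) le) , W″ , nb-tail nbW
  ...   | no ne = _ , s≤s le , step a (step b W″) , nb-step a b W″ ne nbW

  nb-geodesic : ∀ {x y m} (P : Walk G x y m) → NB P → IsDist G x y m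
  nb-geodesic P p = P , λ k W → shortest (shorten W)
    where
    shortest : ∀ {k} → (∃ λ k′ → k′ ≤ k × Σ (Walk G _ _ k′) NB) → _ ≤ k
    shortest (k′ , le , W′ , w′) = subst (_≤ _) (sym (nb-length-unique P W′ p w′)) le

  _++ʷ_ : ∀ {u v w j k} → Walk G u v j → Walk G v w k → Walk G u w (j + k)
  here ++ʷ W = W
  step a W ++ʷ W′ = step a (W ++ʷ W′)

  snoc : ∀ {u v w k} → Walk G u v k → Adj G v w → Walk G u w (suc k)
  snoc here b = step b here
  snoc (step a W) b = step a (snoc W b)

  reverse : ∀ {u v k} → Walk G u v k → Walk G v u k
  reverse here = here
  reverse (step a W) = snoc (reverse W) (adj-sym _ _ a)

  dist-sym : ∀ {x y m} → IsDist G x y m → IsDist G y x m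
  dist-sym (P , minimal) = reverse P , λ k W → minimal k (reverse W)

  -- An acyclic graph has no triangles: the edge ac and the path abc would be
  -- NB walks of different lengths.
  no-triangle : ∀ {a b c} → Adj G a b → Adj G b c → Adj G a c → ⊥
  no-triangle {a} ab bc ac
    with nb-length-unique (step ac here) (step ab (step bc here))
           (nb-edge ac) (nb-step ab bc here (adj⇒≢ ac) (nb-edge bc))
  ... | ()

module TreeBasics {n : ℕ} (G : Graph n) (connected : Connected G) (acyclic : ¬ HasCycle G) where
  open Graph G using (adj) renaming (sym to adj-sym)
  open Degrees G public
  open AcyclicWalks G acyclic public

  Adj? : ∀ u v → Dec (Adj G u v)
  Adj? u v = T? (adj u v)

  nb-walk : ∀ x y → ∃ λ k → Σ (Walk G x y k) NB
  nb-walk x y with shorten (proj₂ (connected x y))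
  ... | k , _ , W , p = k , W , p

  support⇒not-leaf : ∀ {u} → IsSupport G u → ¬ IsLeaf G u
  support⇒not-leaf (_ , d) lf with subst (1 <_) lf d
  ... | s≤s ()

  two-nbrs⇒not-leaf : ∀ {u v w} → Adj G u v → Adj G u w → v ≢ w → ¬ IsLeaf G u
  two-nbrs⇒not-leaf a b v≢w lf = v≢w (leaf-nbr-unique lf a b)

  another-nbr : ∀ {u v} → 1 < degree G u → Adj G u v → ∃ λ w → Adj G u w × w ≢ v
  another-nbr {u} {v} d a with any? (λ w → Adj? u w ×-dec ¬? (w ≟ v))
  ... | yes found = found
  ... | no none with ≤-trans d (nbr-unique⇒deg≤1 v all-v)
    where
    all-v : ∀ w → Adj G u w → w ≡ v
    all-v w b with w ≟ v
    ... | yes e = e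
    ... | no ne = ⊥-elim (none (w , b , ne))
  ... | s≤s ()

  leaf-edge-isolated : ∀ {l u} → IsLeaf G l → Adj G l u → IsLeaf G u →
                       ∀ {x k} → x ≢ l → x ≢ u → Walk G x l k → ⊥
  leaf-edge-isolated lf a lu x≢l x≢u here = x≢l refl
  leaf-edge-isolated {l} {u} lf a lu x≢l x≢u (step {w = w} b W) with w ≟ l | w ≟ u
  ... | yes refl | _ = x≢u (leaf-nbr-unique lf (adj-sym _ _ b) a)
  ... | no _ | yes refl = x≢l (leaf-nbr-unique lu (adj-sym _ _ b) (adj-sym _ _ a))
  ... | no w≢l | no w≢u = leaf-edge-isolated lf a lu w≢l w≢u W

  leaf-nbr-support : ∀ {c l u} → ¬ IsLeaf G c → IsLeaf G l → Adj G l u → IsSupport G u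
  leaf-nbr-support {c} {l} {u} c-nl lf a =
    (l , adj-sym _ _ a , lf) , ≤∧≢⇒< (adj⇒deg≥1 (adj-sym _ _ a)) (≢-sym u-nl)
    where
    u-nl : ¬ IsLeaf G u
    u-nl lu = leaf-edge-isolated lf a lu (λ { refl → c-nl lf }) (λ { refl → c-nl lu })
                (proj₂ (connected c l))

-- The shape of a tree of diameter 5 around its central edge c₁c₂: a longest
-- path x₀ x₁ c₁ c₂ y₁ y₀, and every vertex within distance 3 of c₁ and of c₂.
-- A frame is symmetric in c₁ and c₂ (`swap`), so every fact proved for one end
-- of the central edge also holds for the other.
module Frames {n : ℕ} (G : Graph n) (connected : Connected G) (acyclic : ¬ HasCycle G) where
  open Graph G using () renaming (sym to adj-sym)
  open TreeBasics G connected acyclic public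

  WithinThree : V → Set
  WithinThree c = ∀ {x k} (W : Walk G x c k) → NB W → k ≤ 3

  record Frame (c₁ c₂ : V) : Set where
    field
      central : Adj G c₁ c₂
      x₀ x₁ y₀ y₁ : V
      x₀~x₁ : Adj G x₀ x₁
      x₁~c₁ : Adj G x₁ c₁
      x₀≢c₁ : x₀ ≢ c₁
      x₁≢c₂ : x₁ ≢ c₂
      y₀~y₁ : Adj G y₀ y₁
      y₁~c₂ : Adj G y₁ c₂
      y₀≢c₂ : y₀ ≢ c₂
      y₁≢c₁ : y₁ ≢ c₁
      within₁ : WithinThree c₁
      within₂ : WithinThree c₂

  swap : ∀ {c₁ c₂} → Frame c₁ c₂ → Frame c₂ c₁
  swap F = record
    { central = adj-sym _ _ central ; x₀ = y₀ ; x₁ = y₁ ; y₀ = x₀ ; y₁ = x₁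
    ; x₀~x₁ = y₀~y₁ ; x₁~c₁ = y₁~c₂ ; x₀≢c₁ = y₀≢c₂ ; x₁≢c₂ = y₁≢c₁
    ; y₀~y₁ = x₀~x₁ ; y₁~c₂ = x₁~c₁ ; y₀≢c₂ = x₀≢c₁ ; y₁≢c₁ = x₁≢c₂
    ; within₁ = within₂ ; within₂ = within₁ }
    where open Frame F

  module FrameFacts {c₁ c₂ : V} (F : Frame c₁ c₂) where
    open Frame F

    c₁-not-leaf : ¬ IsLeaf G c₁
    c₁-not-leaf = two-nbrs⇒not-leaf central (adj-sym _ _ x₁~c₁) (≢-sym x₁≢c₂)

    -- x₀ is a leaf: another neighbour w would give an NB walk w x₀ x₁ c₁ c₂ of length 4.
    x₀-leaf : IsLeaf G x₀
    x₀-leaf = ≤-antisym (nbr-unique⇒deg≤1 x₁ only-x₁) (adj⇒deg≥1 x₀~x₁)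
      where
      only-x₁ : ∀ w → Adj G x₀ w → w ≡ x₁
      only-x₁ w a with w ≟ x₁
      ... | yes e = e
      ... | no ne with within₂ (step (adj-sym _ _ a) (step x₀~x₁ (step x₁~c₁ (step central here))))
                        (nb-step _ _ _ ne (nb-step _ _ _ x₀≢c₁ (nb-step _ _ _ x₁≢c₂ (nb-edge central))))
      ... | s≤s (s≤s (s≤s ()))

    x₁-support : IsSupport G x₁
    x₁-support = (x₀ , adj-sym _ _ x₀~x₁ , x₀-leaf) , two-nbrs⇒deg≥2 (adj-sym _ _ x₀~x₁) x₁~c₁ x₀≢c₁

    -- Every vertex of degree > 1 other than c₁, c₂ is a support vertex: otherwise
    -- it would be adjacent to both c₁ and c₂, closing a triangle.
    inner-vertex-support : ∀ {v} → v ≢ c₁ → v ≢ c₂ → 1 < degree G v → IsSupport G v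
    inner-vertex-support {v} v≢c₁ v≢c₂ d with any? (λ z → Adj? v z ×-dec (degree G z ≟ℕ 1))
    ... | yes (z , a , lf) = (z , a , lf) , d
    ... | no no-leaf = ⊥-elim (no-triangle (adjacent c₁ within₁ v≢c₁) central (adjacent c₂ within₂ v≢c₂))
      where
      -- follow a neighbour z off the NB walk from v to c, and a neighbour r ≠ v of
      -- z: the NB walk r z v … c has length ≤ 3, so v is adjacent to c
      adjacent : ∀ c → WithinThree c → v ≢ c → Adj G v c
      adjacent c within v≢c with nb-walk v c
      ... | _ , here , _ = ⊥-elim (v≢c refl)
      ... | _ , step {w = q₁} b Q′ , q with another-nbr d b
      ... | z , v~z , z≢q₁ with degree G z ≟ℕ 1
      ... | yes lf = ⊥-elim (no-leaf (z , v~z , lf))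
      ... | no nlf with another-nbr (≤∧≢⇒< (adj⇒deg≥1 (adj-sym _ _ v~z)) (≢-sym nlf)) (adj-sym _ _ v~z)
      ... | r , z~r , r≢v with Q′ | within (step (adj-sym _ _ z~r) (step (adj-sym _ _ v~z) (step b Q′)))
                                      (nb-step _ _ _ r≢v (nb-step _ _ _ z≢q₁ q))
      ... | here | _ = b
      ... | step _ _ | s≤s (s≤s (s≤s ()))

    vertex-kinds : ∀ v → IsSupport G v ⊎ IsLeaf G v ⊎ v ≡ c₁ ⊎ v ≡ c₂
    vertex-kinds v with v ≟ c₁ | v ≟ c₂
    ... | yes e | _ = inj₂ (inj₂ (inj₁ e))
    ... | no _ | yes e = inj₂ (inj₂ (inj₂ e))
    ... | no v≢c₁ | no v≢c₂ with nb-walk v c₁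
    ... | _ , here , _ = ⊥-elim (v≢c₁ refl)
    ... | _ , step b _ , _ with degree G v ≟ℕ 1
    ... | yes lf = inj₂ (inj₁ lf)
    ... | no nlf = inj₁ (inner-vertex-support v≢c₁ v≢c₂ (≤∧≢⇒< (adj⇒deg≥1 b) (≢-sym nlf)))

    -- A support vertex v other than c₁, c₂ is adjacent to c₁ or to c₂: its leaf
    -- is within distance 3 of both, so v is within distance 2 of both, and two
    -- routes v q c₁ c₂ and v r c₂ of different lengths cannot coexist.
    support-near-centre : ∀ {v} → IsSupport G v → v ≢ c₁ → v ≢ c₂ → Adj G v c₁ ⊎ Adj G v c₂
    support-near-centre {v} ((l , v~l , lf) , d) v≢c₁ v≢c₂
      with within-two c₁ within₁ c₁-not-leaf v≢c₁ | within-two c₂ within₂ c₂-not-leaf v≢c₂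
      where
      c₂-not-leaf : ¬ IsLeaf G c₂
      c₂-not-leaf = two-nbrs⇒not-leaf (adj-sym _ _ central) (adj-sym _ _ y₁~c₂) (≢-sym y₁≢c₁)
      within-two : ∀ c → WithinThree c → ¬ IsLeaf G c → v ≢ c →
                   Adj G v c ⊎ (∃ λ q → Adj G v q × Adj G q c)
      within-two c within c-nl v≢c with nb-walk v c
      ... | _ , here , _ = ⊥-elim (v≢c refl)
      ... | _ , step {w = q₁} b Q′ , q = via Q′ q (within (step (adj-sym _ _ v~l) (step b Q′)) (nb-step _ _ _ (l≢q₁ Q′ q) q))
        where
        l≢q₁ : ∀ {k} (Q′ : Walk G q₁ c k) → NB (step b Q′) → l ≢ q₁
        l≢q₁ here _ refl = c-nl lf
        l≢q₁ (step b₂ _) (nb-step _ _ _ ne _) refl = ne (leaf-nbr-unique lf (adj-sym _ _ v~l) b₂)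
        via : ∀ {k} (Q′ : Walk G q₁ c k) → NB (step b Q′) → suc (suc k) ≤ 3 →
              Adj G v c ⊎ (∃ λ q → Adj G v q × Adj G q c)
        via here _ _ = inj₁ b
        via (step b₂ here) _ _ = inj₂ (q₁ , b , b₂)
        via (step _ (step _ _)) _ (s≤s (s≤s (s≤s ())))
    ... | inj₁ a | _ = inj₁ a
    ... | inj₂ _ | inj₁ a = inj₂ a
    ... | inj₂ (q , v~q , q~c₁) | inj₂ (r , v~r , r~c₂) with q ≟ c₂
    ... | yes refl = inj₂ v~q
    ... | no q≢c₂ with nb-length-unique (step v~q (step q~c₁ (step central here))) (step v~r (step r~c₂ here))
                         (nb-step _ _ _ v≢c₁ (nb-step _ _ _ q≢c₂ (nb-edge central)))
                         (nb-step _ _ _ v≢c₂ (nb-edge r~c₂))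
    ... | ()

    -- Beyond a support vertex b ~ c₂ (b ≠ c₁) there are no support vertices: the
    -- leaf of such a vertex z would be at distance 4 from c₁.
    no-support-beyond : ∀ {b z} → IsSupport G b → Adj G c₂ b → b ≢ c₁ → Adj G b z → z ≢ c₂ →
                        ¬ IsSupport G z
    no-support-beyond {b} {z} b-supp c₂~b b≢c₁ b~z z≢c₂ ((l , z~l , lf) , _)
      with within₁ (step (adj-sym _ _ z~l) (step (adj-sym _ _ b~z) (step (adj-sym _ _ c₂~b)
                      (step (adj-sym _ _ central) here))))
                   (nb-step _ _ _ l≢b (nb-step _ _ _ z≢c₂ (nb-step _ _ _ b≢c₁ (nb-edge _))))
      where
      l≢b : l ≢ b
      l≢b refl = support⇒not-leaf b-supp lf
    ... | s≤s (s≤s (s≤s ()))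

    -- Distinct a ~ c₁ and b ~ c₂ (off the central edge) have no common neighbour w:
    -- a w b and a c₁ c₂ b would be NB walks of lengths 2 and 3.
    no-common-nbr : ∀ {a b w} → a ≢ b → Adj G a c₁ → Adj G b c₂ → a ≢ c₂ → b ≢ c₁ →
                    Adj G a w → Adj G b w → ⊥
    no-common-nbr a≢b a~c₁ b~c₂ a≢c₂ b≢c₁ a~w b~w
      with nb-length-unique (step a~w (step (adj-sym _ _ b~w) here))
             (step a~c₁ (step central (step (adj-sym _ _ b~c₂) here)))
             (nb-step _ _ _ a≢b (nb-edge _)) (nb-step _ _ _ a≢c₂ (nb-step _ _ _ (≢-sym b≢c₁) (nb-edge _)))
    ... | ()

-- In a tree of diameter 5 a longest path v₀ … v₅ has v₂ and v₃ of eccentricity 3,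
-- the least possible; so if the centre is the edge e₁e₂, then {e₁, e₂} = {v₂, v₃}
-- and the longest path provides a frame around e₁e₂.
module DiameterFive {n : ℕ} (G : Graph n) (connected : Connected G) (acyclic : ¬ HasCycle G)
                    (diam : Diam G 5) where
  open Graph G using () renaming (sym to adj-sym)
  open Frames G connected acyclic

  record Path₅ : Set where
    field
      v₀ v₁ v₂ v₃ v₄ v₅ : V
      a₀ : Adj G v₀ v₁
      a₁ : Adj G v₁ v₂
      a₂ : Adj G v₂ v₃
      a₃ : Adj G v₃ v₄
      a₄ : Adj G v₄ v₅
      v₀≢v₂ : v₀ ≢ v₂
      v₁≢v₃ : v₁ ≢ v₃
      v₂≢v₄ : v₂ ≢ v₄
      v₃≢v₅ : v₃ ≢ v₅

  reverse-path : Path₅ → Path₅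
  reverse-path P = record
    { v₀ = v₅ ; v₁ = v₄ ; v₂ = v₃ ; v₃ = v₂ ; v₄ = v₁ ; v₅ = v₀
    ; a₀ = adj-sym _ _ a₄ ; a₁ = adj-sym _ _ a₃ ; a₂ = adj-sym _ _ a₂ ; a₃ = adj-sym _ _ a₁
    ; a₄ = adj-sym _ _ a₀ ; v₀≢v₂ = ≢-sym v₃≢v₅ ; v₁≢v₃ = ≢-sym v₂≢v₄ ; v₂≢v₄ = ≢-sym v₁≢v₃
    ; v₃≢v₅ = ≢-sym v₀≢v₂ }
    where open Path₅ P

  path-of-walk : ∀ {u v} (W : Walk G u v 5) → NB W → Path₅
  path-of-walk (step a₀ (step a₁ (step a₂ (step a₃ (step a₄ here)))))
               (nb-step _ _ _ v₀≢v₂ (nb-step _ _ _ v₁≢v₃ (nb-step _ _ _ v₂≢v₄ (nb-step _ _ _ v₃≢v₅ (nb-edge _))))) =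
    record { a₀ = a₀ ; a₁ = a₁ ; a₂ = a₂ ; a₃ = a₃ ; a₄ = a₄
           ; v₀≢v₂ = v₀≢v₂ ; v₁≢v₃ = v₁≢v₃ ; v₂≢v₄ = v₂≢v₄ ; v₃≢v₅ = v₃≢v₅ }

  at-most-five : ∀ {x y k} (W : Walk G x y k) → NB W → k ≤ 5
  at-most-five W p = proj₂ diam _ _ _ (nb-geodesic W p)

  module _ (P : Path₅) where
    open Path₅ P

    -- Every NB walk from v₂ has length ≤ 3: extended backwards by v₅ v₄ v₃ (if it
    -- starts towards v₁) or by v₀ v₁ (otherwise) it stays NB, hence has length ≤ 5.
    within-three-of-v₂ : ∀ {w k} (W : Walk G v₂ w k) → NB W → k ≤ 3
    within-three-of-v₂ here _ = z≤n
    within-three-of-v₂ (step {w = p₁} b W′) nbW with p₁ ≟ v₁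
    ... | yes refl = ≤-trans (s≤s⁻¹ (s≤s⁻¹ (s≤s⁻¹
          (at-most-five (step (adj-sym _ _ a₄) (step (adj-sym _ _ a₃) (step (adj-sym _ _ a₂) (step b W′))))
            (nb-step _ _ _ (≢-sym v₃≢v₅) (nb-step _ _ _ (≢-sym v₂≢v₄) (nb-step _ _ _ (≢-sym v₁≢v₃) nbW)))))))
          (s≤s (s≤s z≤n))
    ... | no p₁≢v₁ = s≤s⁻¹ (s≤s⁻¹ (at-most-five (step a₀ (step a₁ (step b W′)))
                       (nb-step _ _ _ v₀≢v₂ (nb-step _ _ _ (≢-sym p₁≢v₁) nbW))))

    ecc-v₂ : Ecc G v₂ 3
    ecc-v₂ = (v₅ , nb-geodesic (step a₂ (step a₃ (step a₄ here)))
                     (nb-step _ _ _ v₂≢v₄ (nb-step _ _ _ v₃≢v₅ (nb-edge _))))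
           , bound
      where
      bound : ∀ w k → IsDist G v₂ w k → k ≤ 3
      bound w k (W , minimal) with shorten W
      ... | k′ , _ , W′ , p = ≤-trans (minimal k′ W′) (within-three-of-v₂ W′ p)

  -- Every vertex has eccentricity at least 3, as two vertices are 5 apart.
  ecc≥3 : ∀ w e → Ecc G w e → 3 ≤ e
  ecc≥3 w e (_ , bound) with proj₁ diam
  ... | u , v , _ , minimal with nb-walk w u | nb-walk w v | 3 ≤? e
  ... | _ | _ | yes ok = ok
  ... | d₁ , P₁ , p₁ | d₂ , P₂ , p₂ | no small = ⊥-elim (five≰four
        (≤-trans (minimal _ (reverse P₁ ++ʷ P₂))
                 (+-mono-≤ (≤-trans (bound u d₁ (nb-geodesic P₁ p₁)) e≤2)
                           (≤-trans (bound v d₂ (nb-geodesic P₂ p₂)) e≤2))))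
    where
    e≤2 : e ≤ 2
    e≤2 = s≤s⁻¹ (≰⇒> small)
    five≰four : 5 ≤ 2 + 2 → ⊥
    five≰four (s≤s (s≤s (s≤s (s≤s ()))))

  frame-of-path : (P : Path₅) → Frame (Path₅.v₂ P) (Path₅.v₃ P)
  frame-of-path P = record
    { central = a₂ ; x₀ = v₀ ; x₁ = v₁ ; y₀ = v₅ ; y₁ = v₄ ; x₀~x₁ = a₀ ; x₁~c₁ = a₁
    ; x₀≢c₁ = v₀≢v₂ ; x₁≢c₂ = v₁≢v₃ ; y₀~y₁ = adj-sym _ _ a₄ ; y₁~c₂ = adj-sym _ _ a₃
    ; y₀≢c₂ = ≢-sym v₃≢v₅ ; y₁≢c₁ = ≢-sym v₂≢v₄
    ; within₁ = λ W p → proj₂ (ecc-v₂ P) _ _ (dist-sym (nb-geodesic W p))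
    ; within₂ = λ W p → proj₂ (ecc-v₂ (reverse-path P)) _ _ (dist-sym (nb-geodesic W p)) }
    where open Path₅ P

  central-frame : ∀ e₁ e₂ → CenterIsEdge G e₁ e₂ → Frame e₁ e₂
  central-frame e₁ e₂ (_ , _ , _ , _ , centre-only) with proj₁ diam
  ... | u , v , W , minimal with shorten W
  ... | k′ , le , W′ , p with ≤-antisym le (minimal k′ W′)
  ... | refl = place (in-centre P) (in-centre (reverse-path P))
    where
    P = path-of-walk W′ p
    open Path₅ P
    in-centre : (Q : Path₅) → Path₅.v₂ Q ≡ e₁ ⊎ Path₅.v₂ Q ≡ e₂
    in-centre Q = centre-only (Path₅.v₂ Q) (3 , ecc-v₂ Q , ecc≥3)
    v₂≢v₃ : v₂ ≢ v₃
    v₂≢v₃ = adj⇒≢ a₂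
    place : v₂ ≡ e₁ ⊎ v₂ ≡ e₂ → v₃ ≡ e₁ ⊎ v₃ ≡ e₂ → Frame e₁ e₂
    place (inj₁ x) (inj₁ y) = ⊥-elim (v₂≢v₃ (trans x (sym y)))
    place (inj₁ x) (inj₂ y) = subst₂ Frame x y (frame-of-path P)
    place (inj₂ x) (inj₁ y) = subst₂ Frame y x (frame-of-path (reverse-path P))
    place (inj₂ x) (inj₂ y) = ⊥-elim (v₂≢v₃ (trans x (sym y)))

module Indicators where
  private variable A B : Set

  indicator : Dec A → Fin 2
  indicator (yes _) = zero
  indicator (no _) = suc zero

  indicator-yes : (d : Dec A) → A → indicator d ≡ zero
  indicator-yes (yes _) _ = refl
  indicator-yes (no ¬a) a = ⊥-elim (¬a a)

  indicator-no : (d : Dec A) → ¬ A → indicator d ≡ suc zero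
  indicator-no (yes a) ¬a = ⊥-elim (¬a a)
  indicator-no (no _) _ = refl

  indicator-zero : (d : Dec A) → indicator d ≡ zero → A
  indicator-zero (yes a) _ = a

  indicator-one : (d : Dec A) → indicator d ≡ suc zero → ¬ A
  indicator-one (no ¬a) _ = ¬a

  indicator₂ : Dec A → Dec B → Fin 3
  indicator₂ (yes _) _ = zero
  indicator₂ (no _) e = suc (indicator e)

  indicator₂-first : (d : Dec A) (e : Dec B) → A → indicator₂ d e ≡ zero
  indicator₂-first (yes _) _ _ = refl
  indicator₂-first (no ¬a) _ a = ⊥-elim (¬a a)

  indicator₂-second : (d : Dec A) (e : Dec B) → ¬ A → B → indicator₂ d e ≡ suc zero
  indicator₂-second (yes a) _ ¬a _ = ⊥-elim (¬a a)
  indicator₂-second (no _) e _ b = cong suc (indicator-yes e b)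

  indicator₂-neither : (d : Dec A) (e : Dec B) → ¬ A → ¬ B → indicator₂ d e ≡ suc (suc zero)
  indicator₂-neither (yes a) _ ¬a _ = ⊥-elim (¬a a)
  indicator₂-neither (no _) e _ ¬b = cong suc (indicator-no e ¬b)

  indicator₂-zero : (d : Dec A) (e : Dec B) → indicator₂ d e ≡ zero → A
  indicator₂-zero (yes a) _ _ = a

  indicator₂-one : (d : Dec A) (e : Dec B) → indicator₂ d e ≡ suc zero → B
  indicator₂-one (no _) (yes b) _ = b

-- Building total dominator colourings in which every member of a set S (later:
-- the support vertices) has a colour class of its own.
module SingletonColouring {n : ℕ} (G : Graph n) (S : Subset n) where
  open Graph G using (irrefl)
  open Enumeration

  disjoint-halves : ∀ {K m} (i : Fin K) (j : Fin m) → i ↑ˡ m ≢ K ↑ʳ j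
  disjoint-halves {K} {m} i j e
    with trans (sym (splitAt-↑ˡ K i m)) (trans (cong (splitAt K) e) (splitAt-↑ʳ K m j))
  ... | ()

  module _ (m : ℕ) (extra : Fin n → Fin m) where

    colour : Fin n → Fin (∣ S ∣ + m)
    colour v with v ∈? S
    ... | yes p = rank S v p ↑ˡ m
    ... | no _ = ∣ S ∣ ↑ʳ extra v

    colour-in : ∀ {v} (p : v ∈ S) → colour v ≡ rank S v p ↑ˡ m
    colour-in {v} p with v ∈? S
    ... | yes q = cong (λ z → rank S v z ↑ˡ m) (∈-irrelevant S v q p)
    ... | no ¬p = ⊥-elim (¬p p)

    colour-out : ∀ {v} → v ∉ S → colour v ≡ ∣ S ∣ ↑ʳ extra v
    colour-out {v} ¬p with v ∈? S
    ... | yes p = ⊥-elim (¬p p)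
    ... | no _ = refl

    singleton : ∀ {v w} → w ∈ S → colour v ≡ colour w → v ≡ w
    singleton {v} {w} pw e = by-cases (v ∈? S)
      where
      by-cases : Dec (v ∈ S) → v ≡ w
      by-cases (yes pv) = rank-injective S v w pv pw
                            (↑ˡ-injective m _ _ (trans (sym (colour-in pv)) (trans e (colour-in pw))))
      by-cases (no ¬pv) =
        ⊥-elim (disjoint-halves _ _ (trans (sym (colour-in pw)) (trans (sym e) (colour-out ¬pv))))

    -- u is totally dominated: it has a neighbour in S (a singleton class), or all
    -- vertices outside S with some extra colour j are neighbours of u.
    Dominated : Fin n → Set
    Dominated u = (∃ λ w → w ∈ S × Adj G u w) ⊎
                  (∃ λ j → ∀ v → v ∉ S → extra v ≡ j → Adj G u v)

    singleton-tdc : (∀ u v → u ∉ S → v ∉ S → Adj G u v → extra u ≢ extra v) →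
                    (∀ j → ∃ λ v → v ∉ S × extra v ≡ j) →
                    (∀ u → Dominated u) → HasTDC G (∣ S ∣ + m)
    singleton-tdc proper onto dominated = colour , is-proper , is-onto , dominates
      where
      is-proper : ∀ u v → Adj G u v → colour u ≢ colour v
      is-proper u v a e = by-cases (u ∈? S) (v ∈? S)
        where
        by-cases : Dec (u ∈ S) → Dec (v ∈ S) → ⊥
        by-cases (yes pu) (yes pv) = irrefl u (subst (Adj G u) (sym (singleton pv e)) a)
        by-cases (yes pu) (no ¬pv) =
          disjoint-halves _ _ (trans (sym (colour-in pu)) (trans e (colour-out ¬pv)))
        by-cases (no ¬pu) (yes pv) =
          disjoint-halves _ _ (trans (sym (colour-in pv)) (trans (sym e) (colour-out ¬pu)))
        by-cases (no ¬pu) (no ¬pv) = proper u v ¬pu ¬pv a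
          (↑ʳ-injective ∣ S ∣ _ _ (trans (sym (colour-out ¬pu)) (trans e (colour-out ¬pv))))
      is-onto : ∀ i → ∃ λ u → colour u ≡ i
      is-onto i with splitAt ∣ S ∣ {m} i in eq
      ... | inj₁ r = enum S r , trans (colour-in (enum∈ S r))
                       (trans (cong (_↑ˡ m) (rank-enum S r _)) (splitAt⁻¹-↑ˡ eq))
      ... | inj₂ j with onto j
      ... | v , ¬pv , ej = v , trans (colour-out ¬pv) (trans (cong (∣ S ∣ ↑ʳ_) ej) (splitAt⁻¹-↑ʳ eq))
      dominates : ∀ u → ∃ λ i → ∀ v → colour v ≡ i → Adj G u v
      dominates u with dominated u
      ... | inj₁ (w , pw , a) = colour w , λ v e → subst (Adj G u) (sym (singleton pw e)) a
      ... | inj₂ (j , h) = ∣ S ∣ ↑ʳ j , λ v e → h v (outside v e)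
                             (↑ʳ-injective ∣ S ∣ _ _ (trans (sym (colour-out (outside v e))) e))
        where
        outside : ∀ v → colour v ≡ ∣ S ∣ ↑ʳ j → v ∉ S
        outside v e pv = disjoint-halves _ _ (trans (sym (colour-in pv)) e)

module TDCBounds {n k : ℕ} (G : Graph n) (c : Fin n → Fin k) (tdc : IsTDC G k c) where
  open Graph G using () renaming (sym to adj-sym)
  open Degrees G

  onto : ∀ i → ∃ λ u → c u ≡ i
  onto = proj₁ (proj₂ tdc)

  dominates : ∀ u → ∃ λ i → ∀ v → c v ≡ i → Adj G u v
  dominates = proj₂ (proj₂ tdc)

  -- The class dominated by a leaf l lies in N(l) = {w} and is nonempty, so it is
  -- {w}: every support vertex forms a colour class of its own.
  support-singleton : ∀ {w} → IsSupport G w → ∀ v → c v ≡ c w → v ≡ w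
  support-singleton ((l , w~l , lf) , _) v e with dominates l
  ... | i , l-dom with onto i
  ... | u , cu with leaf-nbr-unique lf (l-dom u cu) (adj-sym _ _ w~l)
  ... | refl = leaf-nbr-unique lf (l-dom v (trans e cu)) (adj-sym _ _ w~l)

  count-colours : (S : Subset n) → (∀ {v} → v ∈ S → IsSupport G v) →
                  ∀ m (xs : Fin m → Fin n) → (∀ j → xs j ∉ S) →
                  (∀ j j′ → c (xs j) ≡ c (xs j′) → j ≡ j′) → ∣ S ∣ + m ≤ k
  count-colours S supp m xs outside distinct =
    Counting.injective-on-plus S c (λ w w′ _ pw′ e → support-singleton (supp pw′) w e) m xs
      (λ j w pw e → outside j (subst (_∈ S) (sym (support-singleton (supp pw) (xs j) e)) pw)) distinct

  dominated-class : ∀ b → ∃ λ x → Adj G b x × (∀ v → c v ≡ c x → Adj G b v)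
  dominated-class b with dominates b
  ... | i , h with onto i
  ... | u , cu = u , h u cu , λ v e → h v (trans e cu)

module Cases {n : ℕ} (G : Graph n) (connected : Connected G) (acyclic : ¬ HasCycle G)
             {c₁ c₂ : Fin n} (F : Frames.Frame G connected acyclic c₁ c₂)
             (S : Subset n) (S-supports : ∀ v → (v ∈ S) ⇔ IsSupport G v) where
  open Graph G using (irrefl) renaming (sym to adj-sym)
  open Frames G connected acyclic
  open Frame F
  open FrameFacts F
  module Opposite = FrameFacts (swap F)
  open SingletonColouring G S
  open Indicators

  ∈S⇒support : ∀ {v} → v ∈ S → IsSupport G v
  ∈S⇒support {v} = Equivalence.to (S-supports v)

  support⇒∈S : ∀ {v} → IsSupport G v → v ∈ S
  support⇒∈S {v} = Equivalence.from (S-supports v)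

  x₁∈S : x₁ ∈ S
  x₁∈S = support⇒∈S x₁-support

  y₁∈S : y₁ ∈ S
  y₁∈S = support⇒∈S Opposite.x₁-support

  leaf∉S : ∀ {l} → IsLeaf G l → l ∉ S
  leaf∉S lf p = support⇒not-leaf (∈S⇒support p) lf

  x₀∉S : x₀ ∉ S
  x₀∉S = leaf∉S x₀-leaf

  x₀≢c₂ : x₀ ≢ c₂
  x₀≢c₂ refl = Opposite.c₁-not-leaf x₀-leaf

  x₁≢y₁ : x₁ ≢ y₁
  x₁≢y₁ refl = no-triangle (adj-sym _ _ x₁~c₁) y₁~c₂ central

  c₂≁x₁ : ¬ Adj G c₂ x₁
  c₂≁x₁ a = no-triangle (adj-sym _ _ x₁~c₁) (adj-sym _ _ a) central

  c₁≁y₁ : ¬ Adj G c₁ y₁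
  c₁≁y₁ a = no-triangle a y₁~c₂ central

  outside-edge : ∀ {u v} → u ∉ S → v ∉ S → Adj G u v → (u ≡ c₁ × v ≡ c₂) ⊎ (u ≡ c₂ × v ≡ c₁)
  outside-edge {u} {v} ¬pu ¬pv a with vertex-kinds u | vertex-kinds v
  ... | inj₁ su | _ = ⊥-elim (¬pu (support⇒∈S su))
  ... | inj₂ (inj₁ lu) | _ = ⊥-elim (¬pv (support⇒∈S (leaf-nbr-support c₁-not-leaf lu a)))
  ... | _ | inj₁ sv = ⊥-elim (¬pv (support⇒∈S sv))
  ... | _ | inj₂ (inj₁ lv) = ⊥-elim (¬pu (support⇒∈S (leaf-nbr-support c₁-not-leaf lv (adj-sym _ _ a))))
  ... | inj₂ (inj₂ (inj₁ refl)) | inj₂ (inj₂ (inj₁ refl)) = ⊥-elim (irrefl _ a)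
  ... | inj₂ (inj₂ (inj₁ e)) | inj₂ (inj₂ (inj₂ e′)) = inj₁ (e , e′)
  ... | inj₂ (inj₂ (inj₂ e)) | inj₂ (inj₂ (inj₁ e′)) = inj₂ (e , e′)
  ... | inj₂ (inj₂ (inj₂ refl)) | inj₂ (inj₂ (inj₂ refl)) = ⊥-elim (irrefl _ a)

  -- Leaves are dominated by their support vertex; so total domination only has
  -- to be checked at c₁, c₂ and at the support vertices next to them.
  all-dominated : ∀ m (extra : Fin n → Fin m) → Dominated m extra c₁ → Dominated m extra c₂ →
                  (∀ u → u ∈ S → Adj G u c₁ → Dominated m extra u) →
                  (∀ u → u ∈ S → Adj G u c₂ → Dominated m extra u) → ∀ u → Dominated m extra u
  all-dominated m extra d₁ d₂ near₁ near₂ u with vertex-kinds u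
  ... | inj₂ (inj₁ lu) with leaf-nbr lu
  ... | w , a = inj₁ (w , support⇒∈S (leaf-nbr-support c₁-not-leaf lu a) , a)
  all-dominated m extra d₁ d₂ near₁ near₂ u | inj₂ (inj₂ (inj₁ refl)) = d₁
  all-dominated m extra d₁ d₂ near₁ near₂ u | inj₂ (inj₂ (inj₂ refl)) = d₂
  all-dominated m extra d₁ d₂ near₁ near₂ u | inj₁ su with u ≟ c₁ | u ≟ c₂
  ... | yes refl | _ = d₁
  ... | no _ | yes refl = d₂
  ... | no u≢c₁ | no u≢c₂ with support-near-centre su u≢c₁ u≢c₂
  ... | inj₁ a = near₁ u (support⇒∈S su) a
  ... | inj₂ a = near₂ u (support⇒∈S su) a

  -- c₁, c₂ ∈ S: all non-supports are leaves, independent, and share one colour.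
  tdc-both-central : c₁ ∈ S → c₂ ∈ S → HasTDC G (∣ S ∣ + 1)
  tdc-both-central p₁ p₂ = singleton-tdc 1 extra proper onto
    (all-dominated 1 extra (inj₁ (c₂ , p₂ , central)) (inj₁ (c₁ , p₁ , adj-sym _ _ central))
       (λ u _ a → inj₁ (c₁ , p₁ , a)) (λ u _ a → inj₁ (c₂ , p₂ , a)))
    where
    extra : Fin n → Fin 1
    extra _ = zero
    proper : ∀ u v → u ∉ S → v ∉ S → Adj G u v → extra u ≢ extra v
    proper u v ¬pu ¬pv a with outside-edge ¬pu ¬pv a
    ... | inj₁ (refl , _) = ⊥-elim (¬pu p₁)
    ... | inj₂ (refl , _) = ⊥-elim (¬pu p₂)
    onto : ∀ j → ∃ λ v → v ∉ S × extra v ≡ j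
    onto zero = x₀ , x₀∉S , refl

  -- c₁ ∈ S, c₂ ∉ S: c₂ gets a colour of its own, dominating its neighbours.
  tdc-one-central : c₁ ∈ S → c₂ ∉ S → HasTDC G (∣ S ∣ + 2)
  tdc-one-central p₁ ¬p₂ = singleton-tdc 2 extra proper onto
    (all-dominated 2 extra (inj₂ (zero , λ v _ e → subst (Adj G c₁) (sym (is-c₂ e)) central))
       (inj₁ (c₁ , p₁ , adj-sym _ _ central))
       (λ u _ a → inj₁ (c₁ , p₁ , a)) (λ u _ a → inj₂ (zero , λ v _ e → subst (Adj G u) (sym (is-c₂ e)) a)))
    where
    extra : Fin n → Fin 2
    extra v = indicator (v ≟ c₂)
    is-c₂ : ∀ {v} → extra v ≡ zero → v ≡ c₂
    is-c₂ {v} = indicator-zero (v ≟ c₂)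
    proper : ∀ u v → u ∉ S → v ∉ S → Adj G u v → extra u ≢ extra v
    proper u v ¬pu ¬pv a with outside-edge ¬pu ¬pv a
    ... | inj₁ (refl , _) = ⊥-elim (¬pu p₁)
    ... | inj₂ (_ , refl) = ⊥-elim (¬pv p₁)
    onto : ∀ j → ∃ λ v → v ∉ S × extra v ≡ j
    onto zero = c₂ , ¬p₂ , indicator-yes (c₂ ≟ c₂) refl
    onto (suc zero) = x₀ , x₀∉S , indicator-no (x₀ ≟ c₂) x₀≢c₂

  -- S = {x₁, y₁}: the non-supports split into N(x₁) ∖ S and N(y₁) ∖ S.
  tdc-two-supports : c₁ ∉ S → c₂ ∉ S → (∀ v → v ∈ S → v ≡ x₁ ⊎ v ≡ y₁) → HasTDC G (∣ S ∣ + 2)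
  tdc-two-supports ¬p₁ ¬p₂ S⊆ = singleton-tdc 2 extra proper onto
    (all-dominated 2 extra (inj₁ (x₁ , x₁∈S , adj-sym _ _ x₁~c₁)) (inj₁ (y₁ , y₁∈S , adj-sym _ _ y₁~c₂))
       near₁ near₂)
    where
    extra : Fin n → Fin 2
    extra v = indicator (Adj? v x₁)
    proper : ∀ u v → u ∉ S → v ∉ S → Adj G u v → extra u ≢ extra v
    proper u v ¬pu ¬pv a e with outside-edge ¬pu ¬pv a
    ... | inj₁ (refl , refl) =
      c₂≁x₁ (indicator-zero (Adj? c₂ x₁) (trans (sym e) (indicator-yes (Adj? c₁ x₁) (adj-sym _ _ x₁~c₁))))
    ... | inj₂ (refl , refl) =
      c₂≁x₁ (indicator-zero (Adj? c₂ x₁) (trans e (indicator-yes (Adj? c₁ x₁) (adj-sym _ _ x₁~c₁))))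
    onto : ∀ j → ∃ λ v → v ∉ S × extra v ≡ j
    onto zero = c₁ , ¬p₁ , indicator-yes (Adj? c₁ x₁) (adj-sym _ _ x₁~c₁)
    onto (suc zero) = c₂ , ¬p₂ , indicator-no (Adj? c₂ x₁) c₂≁x₁
    near₁ : ∀ u → u ∈ S → Adj G u c₁ → Dominated 2 extra u
    near₁ u pu a with S⊆ u pu
    ... | inj₁ refl = inj₂ (zero , λ v _ e → adj-sym _ _ (indicator-zero (Adj? v x₁) e))
    ... | inj₂ refl = ⊥-elim (c₁≁y₁ (adj-sym _ _ a))
    -- every non-support vertex not adjacent to x₁ is adjacent to y₁
    near₂ : ∀ u → u ∈ S → Adj G u c₂ → Dominated 2 extra u
    near₂ u pu a with S⊆ u pu
    ... | inj₁ refl = ⊥-elim (c₂≁x₁ (adj-sym _ _ a))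
    ... | inj₂ refl = inj₂ (suc zero , y₁-dominates)
      where
      y₁-dominates : ∀ v → v ∉ S → extra v ≡ suc zero → Adj G y₁ v
      y₁-dominates v ¬pv e with vertex-kinds v
      ... | inj₁ sv = ⊥-elim (¬pv (support⇒∈S sv))
      ... | inj₂ (inj₂ (inj₁ refl)) = ⊥-elim (indicator-one (Adj? c₁ x₁) e (adj-sym _ _ x₁~c₁))
      ... | inj₂ (inj₂ (inj₂ refl)) = y₁~c₂
      ... | inj₂ (inj₁ lv) with leaf-nbr lv
      ... | w , v~w with S⊆ w (support⇒∈S (leaf-nbr-support c₁-not-leaf lv v~w))
      ... | inj₁ refl = ⊥-elim (indicator-one (Adj? v x₁) e v~w)
      ... | inj₂ refl = adj-sym _ _ v~w

  -- c₁, c₂ ∉ S: c₁ and c₂ get colours of their own, the leaves a third one.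
  tdc-no-central : c₁ ∉ S → c₂ ∉ S → HasTDC G (∣ S ∣ + 3)
  tdc-no-central ¬p₁ ¬p₂ = singleton-tdc 3 extra proper onto
    (all-dominated 3 extra (inj₁ (x₁ , x₁∈S , adj-sym _ _ x₁~c₁)) (inj₁ (y₁ , y₁∈S , adj-sym _ _ y₁~c₂))
       (λ u _ a → inj₂ (zero , λ v _ e → subst (Adj G u) (sym (is-c₁ e)) a))
       (λ u _ a → inj₂ (suc zero , λ v _ e → subst (Adj G u) (sym (is-c₂ e)) a)))
    where
    extra : Fin n → Fin 3
    extra v = indicator₂ (v ≟ c₁) (v ≟ c₂)
    is-c₁ : ∀ {v} → extra v ≡ zero → v ≡ c₁
    is-c₁ {v} = indicator₂-zero (v ≟ c₁) (v ≟ c₂)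
    is-c₂ : ∀ {v} → extra v ≡ suc zero → v ≡ c₂
    is-c₂ {v} = indicator₂-one (v ≟ c₁) (v ≟ c₂)
    c₂≢c₁ : c₂ ≢ c₁
    c₂≢c₁ = ≢-sym (adj⇒≢ central)
    extra-c₁ : extra c₁ ≡ zero
    extra-c₁ = indicator₂-first (c₁ ≟ c₁) (c₁ ≟ c₂) refl
    proper : ∀ u v → u ∉ S → v ∉ S → Adj G u v → extra u ≢ extra v
    proper u v ¬pu ¬pv a e with outside-edge ¬pu ¬pv a
    ... | inj₁ (refl , refl) = c₂≢c₁ (is-c₁ (trans (sym e) extra-c₁))
    ... | inj₂ (refl , refl) = c₂≢c₁ (is-c₁ (trans e extra-c₁))
    onto : ∀ j → ∃ λ v → v ∉ S × extra v ≡ j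
    onto zero = c₁ , ¬p₁ , extra-c₁
    onto (suc zero) = c₂ , ¬p₂ , indicator₂-second (c₂ ≟ c₁) (c₂ ≟ c₂) c₂≢c₁ refl
    onto (suc (suc zero)) = x₀ , x₀∉S , indicator₂-neither (x₀ ≟ c₁) (x₀ ≟ c₂) x₀≢c₁ x₀≢c₂

  beyond-support₁ : c₁ ∉ S → ∀ {a} → a ∈ S → Adj G a c₁ → a ≢ c₂ → ∀ z → Adj G a z → z ∉ S
  beyond-support₁ ¬p₁ {a} pa a~c₁ a≢c₂ z a~z with z ≟ c₁
  ... | yes refl = ¬p₁
  ... | no z≢c₁ = λ pz →
    Opposite.no-support-beyond (∈S⇒support pa) (adj-sym _ _ a~c₁) a≢c₂ a~z z≢c₁ (∈S⇒support pz)

  beyond-support₂ : c₂ ∉ S → ∀ {b} → b ∈ S → Adj G b c₂ → b ≢ c₁ → ∀ z → Adj G b z → z ∉ S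
  beyond-support₂ ¬p₂ {b} pb b~c₂ b≢c₁ z b~z with z ≟ c₂
  ... | yes refl = ¬p₂
  ... | no z≢c₂ = λ pz →
    no-support-beyond (∈S⇒support pb) (adj-sym _ _ b~c₂) b≢c₁ b~z z≢c₂ (∈S⇒support pz)

  module LowerBounds {k : ℕ} (c : Fin n → Fin k) (tdc : IsTDC G k c) where
    open TDCBounds G c tdc

    count : ∀ m (xs : Fin m → Fin n) → (∀ j → xs j ∉ S) →
            (∀ j j′ → c (xs j) ≡ c (xs j′) → j ≡ j′) → ∣ S ∣ + m ≤ k
    count = count-colours S ∈S⇒support

    class-outside : ∀ b → (∀ z → Adj G b z → z ∉ S) →
                    ∃ λ x → x ∉ S × Adj G b x × (∀ v → c v ≡ c x → Adj G b v)
    class-outside b outside with dominated-class b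
    ... | x , b~x , class = x , outside x b~x , b~x , class

    distinct₂ : ∀ {x y} → c x ≢ c y → ∀ j j′ →
                c (lookup (x ∷ y ∷ []) j) ≡ c (lookup (x ∷ y ∷ []) j′) → j ≡ j′
    distinct₂ ne zero zero _ = refl
    distinct₂ ne zero (suc zero) e = ⊥-elim (ne e)
    distinct₂ ne (suc zero) zero e = ⊥-elim (ne (sym e))
    distinct₂ ne (suc zero) (suc zero) _ = refl

    distinct₃ : ∀ {x y z} → c x ≢ c y → c x ≢ c z → c y ≢ c z → ∀ j j′ →
                c (lookup (x ∷ y ∷ z ∷ []) j) ≡ c (lookup (x ∷ y ∷ z ∷ []) j′) → j ≡ j′
    distinct₃ xy xz yz zero zero _ = refl
    distinct₃ xy xz yz zero (suc zero) e = ⊥-elim (xy e)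
    distinct₃ xy xz yz zero (suc (suc zero)) e = ⊥-elim (xz e)
    distinct₃ xy xz yz (suc zero) zero e = ⊥-elim (xy (sym e))
    distinct₃ xy xz yz (suc zero) (suc zero) _ = refl
    distinct₃ xy xz yz (suc zero) (suc (suc zero)) e = ⊥-elim (yz e)
    distinct₃ xy xz yz (suc (suc zero)) zero e = ⊥-elim (xz (sym e))
    distinct₃ xy xz yz (suc (suc zero)) (suc zero) e = ⊥-elim (yz (sym e))
    distinct₃ xy xz yz (suc (suc zero)) (suc (suc zero)) _ = refl

    -- A neighbour x of a vertex a ~ c₁ (a ≠ y₁, c₂) never shares its colour with
    -- the class dominated by y₁, as a and y₁ have no common neighbour.
    apart-from-y₁-class : ∀ {a x y} → a ≢ y₁ → Adj G a c₁ → a ≢ c₂ → Adj G a x →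
                          (∀ v → c v ≡ c y → Adj G y₁ v) → c x ≢ c y
    apart-from-y₁-class a≢y₁ a~c₁ a≢c₂ a~x class-y e =
      no-common-nbr a≢y₁ a~c₁ y₁~c₂ a≢c₂ y₁≢c₁ a~x (class-y _ e)

    -- the leaf x₀ is not a support vertex
    at-least-one-more : ∣ S ∣ + 1 ≤ k
    at-least-one-more = count 1 (λ _ → x₀) (λ _ → x₀∉S) λ { zero zero _ → refl }

    -- c₁ ∈ S, c₂ ∉ S: the class dominated by y₁ and the leaf l of c₁ differ,
    -- since l is not adjacent to y₁.
    at-least-two-more-one-central : c₁ ∈ S → c₂ ∉ S → ∣ S ∣ + 2 ≤ k
    at-least-two-more-one-central p₁ ¬p₂
      with class-outside y₁ (beyond-support₂ ¬p₂ y₁∈S y₁~c₂ y₁≢c₁) | ∈S⇒support p₁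
    ... | x , ¬px , _ , class | (l , c₁~l , lf) , _ =
      count 2 (lookup (x ∷ l ∷ [])) (λ { zero → ¬px ; (suc zero) → leaf∉S lf }) (distinct₂ x≁l)
      where
      x≁l : c x ≢ c l
      x≁l e = y₁≢c₁ (leaf-nbr-unique lf (adj-sym _ _ (class l (sym e))) (adj-sym _ _ c₁~l))

    -- c₁, c₂ ∉ S: the classes dominated by x₁ and by y₁ differ, since x₁ and y₁
    -- have no common neighbour.
    at-least-two-more-no-central : c₁ ∉ S → c₂ ∉ S → ∣ S ∣ + 2 ≤ k
    at-least-two-more-no-central ¬p₁ ¬p₂
      with class-outside x₁ (beyond-support₁ ¬p₁ x₁∈S x₁~c₁ x₁≢c₂)
         | class-outside y₁ (beyond-support₂ ¬p₂ y₁∈S y₁~c₂ y₁≢c₁)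
    ... | x , ¬px , x₁~x , _ | y , ¬py , _ , class-y =
      count 2 (lookup (x ∷ y ∷ [])) (λ { zero → ¬px ; (suc zero) → ¬py })
        (distinct₂ (apart-from-y₁-class x₁≢y₁ x₁~c₁ x₁≢c₂ x₁~x class-y))

    -- c₁, c₂ ∉ S with a further support vertex a ~ c₁: the classes dominated by
    -- x₁, a and y₁ give three colours, unless x₁ and a dominate the same class,
    -- in which case the leaf x₀ (not adjacent to a) supplies the third colour.
    at-least-three-more : c₁ ∉ S → c₂ ∉ S → ∀ {a} → a ∈ S → Adj G a c₁ → a ≢ x₁ → ∣ S ∣ + 3 ≤ k
    at-least-three-more ¬p₁ ¬p₂ {a} pa a~c₁ a≢x₁
      with class-outside x₁ (beyond-support₁ ¬p₁ x₁∈S x₁~c₁ x₁≢c₂)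
         | class-outside a (beyond-support₁ ¬p₁ pa a~c₁ (λ { refl → ¬p₂ pa }))
         | class-outside y₁ (beyond-support₂ ¬p₂ y₁∈S y₁~c₂ y₁≢c₁)
    ... | x , ¬px , x₁~x , _ | x′ , ¬px′ , a~x′ , class-a | y , ¬py , _ , class-y with c x ≟ c x′
    ... | no x≁x′ =
      count 3 (lookup (x ∷ x′ ∷ y ∷ [])) (λ { zero → ¬px ; (suc zero) → ¬px′ ; (suc (suc zero)) → ¬py })
        (distinct₃ x≁x′ (apart-from-y₁-class x₁≢y₁ x₁~c₁ x₁≢c₂ x₁~x class-y)
                        (apart-from-y₁-class a≢y₁ a~c₁ (λ { refl → ¬p₂ pa }) a~x′ class-y))
      where
      a≢y₁ : a ≢ y₁
      a≢y₁ refl = c₁≁y₁ (adj-sym _ _ a~c₁)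
    ... | yes x∼x′ =
      count 3 (lookup (x ∷ x₀ ∷ y ∷ [])) (λ { zero → ¬px ; (suc zero) → x₀∉S ; (suc (suc zero)) → ¬py })
        (distinct₃ x≁x₀ (apart-from-y₁-class x₁≢y₁ x₁~c₁ x₁≢c₂ x₁~x class-y) x₀≁y)
      where
      x≁x₀ : c x ≢ c x₀
      x≁x₀ e = a≢x₁ (leaf-nbr-unique x₀-leaf (adj-sym _ _ (class-a x₀ (trans (sym e) x∼x′))) x₀~x₁)
      x₀≁y : c x₀ ≢ c y
      x₀≁y e = x₁≢y₁ (leaf-nbr-unique x₀-leaf x₀~x₁ (adj-sym _ _ (class-y x₀ e)))

  two-supports : ∣ S ∣ ≡ 2 → ∀ v → v ∈ S → v ≡ x₁ ⊎ v ≡ y₁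
  two-supports two = Counting.two-members-exhaust S x₁ y₁ (subst (_≤ 2) (sym two) ≤-refl) x₁∈S y₁∈S x₁≢y₁

  c₁∉S-if-two : ∣ S ∣ ≡ 2 → c₁ ∉ S
  c₁∉S-if-two two p with two-supports two c₁ p
  ... | inj₁ e = adj⇒≢ x₁~c₁ (sym e)
  ... | inj₂ e = y₁≢c₁ (sym e)

  c₂∉S-if-two : ∣ S ∣ ≡ 2 → c₂ ∉ S
  c₂∉S-if-two two p with two-supports two c₂ p
  ... | inj₁ e = x₁≢c₂ (sym e)
  ... | inj₂ e = adj⇒≢ y₁~c₂ (sym e)

  -- If c₁, c₂ ∉ S and ∣ S ∣ ≥ 3, some support vertex other than x₁ and y₁ exists;
  -- by `support-near-centre` it is adjacent to c₁ or to c₂.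
  third-support : c₁ ∉ S → c₂ ∉ S → 3 ≤ ∣ S ∣ →
                  (∃ λ a → a ∈ S × Adj G a c₁ × a ≢ x₁) ⊎ (∃ λ b → b ∈ S × Adj G b c₂ × b ≢ y₁)
  third-support ¬p₁ ¬p₂ three
    with any? (λ v → (v ∈? S) ×-dec (Adj? v c₁ ×-dec ¬? (v ≟ x₁)))
       | any? (λ v → (v ∈? S) ×-dec (Adj? v c₂ ×-dec ¬? (v ≟ y₁)))
  ... | yes (a , pa , a~c₁ , a≢x₁) | _ = inj₁ (a , pa , a~c₁ , a≢x₁)
  ... | no _ | yes (b , pb , b~c₂ , b≢y₁) = inj₂ (b , pb , b~c₂ , b≢y₁)
  ... | no none₁ | no none₂ with ≤-trans three (Counting.covered-by-two S x₁ y₁ only-x₁-y₁)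
    where
    only-x₁-y₁ : ∀ v → v ∈ S → v ≡ x₁ ⊎ v ≡ y₁
    only-x₁-y₁ v pv with support-near-centre (∈S⇒support pv) (λ { refl → ¬p₁ pv }) (λ { refl → ¬p₂ pv })
    ... | inj₁ a with v ≟ x₁
    ... | yes e = inj₁ e
    ... | no ne = ⊥-elim (none₁ (v , pv , a , ne))
    only-x₁-y₁ v pv | inj₂ a with v ≟ y₁
    ... | yes e = inj₂ e
    ... | no ne = ⊥-elim (none₂ (v , pv , a , ne))
  ... | s≤s (s≤s ())

  χ-both-central : c₁ ∈ S → c₂ ∈ S → χdt≡ G (∣ S ∣ + 1)
  χ-both-central p₁ p₂ = tdc-both-central p₁ p₂ , λ k (c , tdc) → LowerBounds.at-least-one-more c tdc

  χ-one-central : c₁ ∈ S → c₂ ∉ S → χdt≡ G (∣ S ∣ + 2)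
  χ-one-central p₁ ¬p₂ =
    tdc-one-central p₁ ¬p₂ , λ k (c , tdc) → LowerBounds.at-least-two-more-one-central c tdc p₁ ¬p₂

  χ-two-supports : ∣ S ∣ ≡ 2 → χdt≡ G (∣ S ∣ + 2)
  χ-two-supports two =
    tdc-two-supports ¬p₁ ¬p₂ (two-supports two) ,
    λ k (c , tdc) → LowerBounds.at-least-two-more-no-central c tdc ¬p₁ ¬p₂
    where
    ¬p₁ : c₁ ∉ S
    ¬p₁ = c₁∉S-if-two two
    ¬p₂ : c₂ ∉ S
    ¬p₂ = c₂∉S-if-two two

  χ-no-central : c₁ ∉ S → c₂ ∉ S → ∀ {a} → a ∈ S → Adj G a c₁ → a ≢ x₁ → χdt≡ G (∣ S ∣ + 3)
  χ-no-central ¬p₁ ¬p₂ pa a~c₁ a≢x₁ =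
    tdc-no-central ¬p₁ ¬p₂ , λ k (c , tdc) → LowerBounds.at-least-three-more c tdc ¬p₁ ¬p₂ pa a~c₁ a≢x₁

proposition6p7 : (n : ℕ) (G : Graph n) → IsTree G → Diam G 5 →
    (e₁ e₂ : Fin n) → CenterIsEdge G e₁ e₂ →
    (S : Subset n) → (∀ v → (v ∈ S) ⇔ IsSupport G v) →
    ((e₁ ∈ S × e₂ ∈ S) → χdt≡ G (∣ S ∣ + 1)) ×
    ((∣ S ∣ ≡ 2 ⊎ ((e₁ ∈ S × e₂ ∉ S) ⊎ (e₁ ∉ S × e₂ ∈ S))) → χdt≡ G (∣ S ∣ + 2)) ×
    ((e₁ ∉ S × e₂ ∉ S × ∣ S ∣ ≥ 3) → χdt≡ G (∣ S ∣ + 3))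
proposition6p7 n G (connected , acyclic) diam e₁ e₂ centre S S-supports = case₁ , case₂ , case₃
  where
  F : Frames.Frame G connected acyclic e₁ e₂
  F = DiameterFive.central-frame G connected acyclic diam e₁ e₂ centre
  module C = Cases G connected acyclic F S S-supports
  module C′ = Cases G connected acyclic (Frames.swap G connected acyclic F) S S-supports

  case₁ : (e₁ ∈ S × e₂ ∈ S) → χdt≡ G (∣ S ∣ + 1)
  case₁ (p₁ , p₂) = C.χ-both-central p₁ p₂

  case₂ : (∣ S ∣ ≡ 2 ⊎ ((e₁ ∈ S × e₂ ∉ S) ⊎ (e₁ ∉ S × e₂ ∈ S))) → χdt≡ G (∣ S ∣ + 2)
  case₂ (inj₁ two) = C.χ-two-supports two
  case₂ (inj₂ (inj₁ (p₁ , ¬p₂))) = C.χ-one-central p₁ ¬p₂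
  case₂ (inj₂ (inj₂ (¬p₁ , p₂))) = C′.χ-one-central p₂ ¬p₁

  -- the lower bound is argued on the side of the central edge carrying a third support vertex
  case₃ : (e₁ ∉ S × e₂ ∉ S × ∣ S ∣ ≥ 3) → χdt≡ G (∣ S ∣ + 3)
  case₃ (¬p₁ , ¬p₂ , three) with C.third-support ¬p₁ ¬p₂ three
  ... | inj₁ (a , pa , a~e₁ , a≢x₁) = C.χ-no-central ¬p₁ ¬p₂ pa a~e₁ a≢x₁
  ... | inj₂ (b , pb , b~e₂ , b≢y₁) = C′.χ-no-central ¬p₂ ¬p₁ pb b~e₂ b≢y₁
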